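{- A locale is compact and regular if and only if it is isomorphic to the frame $\mathcal{R}(P,\lhd)$ of round ideals of some pcd-lattice $P$ endowed with a strong inclusion $\lhd$ on $P$. That is, compact regular frames are precisely the frames of round ideals over some pcd-lattice endowed with a strong inclusion.
   Context: Setting: constructive set theory (CZF + RRS-$\bigcup$REA; no Powerset, only Restricted Separation). A locale is a set-generated class-frame $(L,B_L)$: for every $x\in L$, $\{b\in B_L: b\le x\}$ is a set with join $x$. $L$ is compact if every cover of $1$ by a set of basic elements has a finite subcover; $L$ is regular if $a=\bigvee\{b\in B_L: b\prec a\}$ for all $a\in B_L$, where $y\prec x$ iff $1=x\vee y^*$, $y^*$ the pseudocomplement. A pcd-lattice is a partial order $(P,\le)$ with $P,\le$ sets, which is a pseudocomplemented distributive lattice. A strong inclusion on $P$ is a binary set-relation $\lhd$ on $P$ with: (1) $0\lhd 0$, $1\lhd 1$; (2) $x\le a\lhd b\le y$ implies $x\lhd y$; (3) $x\lhd a$, $x\lhd b$ imply $x\lhd a\wedge b$; (4) $x\lhd a$, $y\lhd a$ imply $x\vee y\lhd a$; (5) $a\lhd b$ implies $b^*\lhd a^*$; (6) $\lhd\subseteq\prec$; (7) $x\lhd y$ implies $x\lhd z\lhd y$ for some $z\in P$. A round ideal is an ideal $I$ of $P$ such that for every $b\in I$ there is $a\in I$ with $b\lhd a$; $\mathcal{R}(P,\lhd)$ is the class-frame of round ideals ordered by inclusion, set-generated by the basis $\{\Downarrow a: a\in P\}$, where $\Downarrow a=\{b\in P: b\lhd a\}$. The two directions: (a) for any pcd-lattice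 $P$ and strong inclusion $\lhd$ on $P$, $(\mathcal{R}(P,\lhd),\{\Downarrow a:a\in P\})$ is a compact regular locale; (b) conversely, if $L$ is a compact regular locale with basis $B$, let $B^*$ be the (set) closure of $B$ inside $L$ under finite meets, finite joins and pseudocomplements; then the well-inside relation $\prec$ restricted to $B^*$ is a strong inclusion on $B^*$ (it interpolates since $L$ is compact regular), and $\mathcal{R}(B^*,\prec)$ is isomorphic to $L$ via $\Downarrow b\mapsto\bigvee\Downarrow b$. -}

module Defs where

open import Level using (Level; 0ℓ) renaming (suc to lsuc)
open import Data.Nat using (ℕ)
open import Data.Fin using (Fin)
open import Data.Bool using (Bool; true; false)
open import Data.Empty using (⊥)
open import Data.Product using (Σ; Σ-syntax; ∃; ∃-syntax; _×_; _,_; proj₁; proj₂)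
open import Function.Bundles using (_⇔_)

-- "Sets" are types in Set (= Set 0ℓ); "classes" are types in Set₁.
-- Orders are Set-valued (small) relations; equality of elements is the
-- order-induced equivalence (no quotients in Agda).

record Locale : Set₂ where
  field
    Carrier : Set₁
    _≤_     : Carrier → Carrier → Set
    ≤-refl  : ∀ {x} → x ≤ x
    ≤-trans : ∀ {x y z} → x ≤ y → y ≤ z → x ≤ z
    ⊤       : Carrier
    ⊤-max   : ∀ {x} → x ≤ ⊤
    _∧_     : Carrier → Carrier → Carrier
    ∧-lb₁   : ∀ {x y} → (x ∧ y) ≤ x
    ∧-lb₂   : ∀ {x y} → (x ∧ y) ≤ y
    ∧-glb   : ∀ {x y z} → z ≤ x → z ≤ y → z ≤ (x ∧ y)
    ⋁       : {I : Set} → (I → Carrier) → Carrier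
    ⋁-ub    : ∀ {I : Set} (f : I → Carrier) (i : I) → f i ≤ ⋁ f
    ⋁-lub   : ∀ {I : Set} (f : I → Carrier) {z} → (∀ i → f i ≤ z) → ⋁ f ≤ z
    ∧-⋁-distrib : ∀ {I : Set} (x : Carrier) (f : I → Carrier) →
                  (x ∧ ⋁ f) ≤ ⋁ (λ i → x ∧ f i)
    Basis   : Set
    emb     : Basis → Carrier
    generated : ∀ x → x ≤ ⋁ {Σ[ b ∈ Basis ] (emb b ≤ x)} (λ p → emb (proj₁ p))

module LocaleNotions (L : Locale) where
  open Locale L

  _≈_ : Carrier → Carrier → Set
  x ≈ y = (x ≤ y) × (y ≤ x)

  ⊥L : Carrier
  ⊥L = ⋁ {⊥} (λ ())

  _∨_ : Carrier → Carrier → Carrier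
  x ∨ y = ⋁ {Bool} (λ { true → x ; false → y })

  _* : Carrier → Carrier
  x * = ⋁ {Σ[ b ∈ Basis ] ((emb b ∧ x) ≤ ⊥L)} (λ p → emb (proj₁ p))

  _≺_ : Carrier → Carrier → Set
  y ≺ x = ⊤ ≤ (x ∨ (y *))

  IsCompact : Set₁
  IsCompact = ∀ (I : Set) (g : I → Basis) → ⊤ ≤ ⋁ (λ i → emb (g i)) →
              Σ[ n ∈ ℕ ] Σ[ h ∈ (Fin n → I) ] (⊤ ≤ ⋁ (λ k → emb (g (h k))))

  IsRegular : Set
  IsRegular = ∀ (a : Basis) →
              emb a ≈ ⋁ {Σ[ b ∈ Basis ] (emb b ≺ emb a)} (λ p → emb (proj₁ p))

record PcdLattice : Set₁ where
  field
    Carrier : Set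
    _≤_     : Carrier → Carrier → Set
    ≤-refl  : ∀ {x} → x ≤ x
    ≤-trans : ∀ {x y z} → x ≤ y → y ≤ z → x ≤ z
    𝟘 𝟙     : Carrier
    𝟘-min   : ∀ {x} → 𝟘 ≤ x
    𝟙-max   : ∀ {x} → x ≤ 𝟙
    _∧_ _∨_ : Carrier → Carrier → Carrier
    ∧-lb₁   : ∀ {x y} → (x ∧ y) ≤ x
    ∧-lb₂   : ∀ {x y} → (x ∧ y) ≤ y
    ∧-glb   : ∀ {x y z} → z ≤ x → z ≤ y → z ≤ (x ∧ y)
    ∨-ub₁   : ∀ {x y} → x ≤ (x ∨ y)
    ∨-ub₂   : ∀ {x y} → y ≤ (x ∨ y)
    ∨-lub   : ∀ {x y z} → x ≤ z → y ≤ z → (x ∨ y) ≤ z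
    distrib : ∀ {x y z} → (x ∧ (y ∨ z)) ≤ ((x ∧ y) ∨ (x ∧ z))
    _*      : Carrier → Carrier
    pseudo  : ∀ {x y} → ((x ∧ y) ≤ 𝟘) ⇔ (x ≤ (y *))

module PcdNotions (P : PcdLattice) where
  open PcdLattice P

  _≺_ : Carrier → Carrier → Set
  y ≺ x = 𝟙 ≤ (x ∨ (y *))

  record IsStrongInclusion (_◁_ : Carrier → Carrier → Set) : Set where
    field
      si-𝟘     : 𝟘 ◁ 𝟘
      si-𝟙     : 𝟙 ◁ 𝟙
      si-mono  : ∀ {x a b y} → x ≤ a → a ◁ b → b ≤ y → x ◁ y
      si-∧     : ∀ {x a b} → x ◁ a → x ◁ b → x ◁ (a ∧ b)
      si-∨     : ∀ {x y a} → x ◁ a → y ◁ a → (x ∨ y) ◁ a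
      si-*     : ∀ {a b} → a ◁ b → (b *) ◁ (a *)
      si-≺     : ∀ {x y} → x ◁ y → x ≺ y
      si-interp : ∀ {x y} → x ◁ y → Σ[ z ∈ Carrier ] ((x ◁ z) × (z ◁ y))

  record RoundIdeal (_◁_ : Carrier → Carrier → Set) : Set₁ where
    field
      mem      : Carrier → Set
      has-𝟘    : mem 𝟘
      down     : ∀ {x y} → x ≤ y → mem y → mem x
      ∨-closed : ∀ {x y} → mem x → mem y → mem (x ∨ y)
      round    : ∀ {b} → mem b → Σ[ a ∈ Carrier ] (mem a × (b ◁ a))
  open RoundIdeal public

  _⊆_ : ∀ {◁} → RoundIdeal ◁ → RoundIdeal ◁ → Set
  I ⊆ J = ∀ x → mem I x → mem J x

-- Isomorphism between a locale and R(P,◁): an order isomorphism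
-- (which automatically preserves all frame operations).

record Iso≅R (L : Locale) (P : PcdLattice)
             (_◁_ : PcdLattice.Carrier P → PcdLattice.Carrier P → Set) : Set₁ where
  open Locale L
  open PcdNotions P
  field
    to       : Carrier → RoundIdeal _◁_
    from     : RoundIdeal _◁_ → Carrier
    to-mono  : ∀ {x y} → x ≤ y → to x ⊆ to y
    from-mono : ∀ {I J} → I ⊆ J → from I ≤ from J
    to-from  : ∀ I → (to (from I) ⊆ I) × (I ⊆ to (from I))
    from-to  : ∀ x → (from (to x) ≤ x) × (x ≤ from (to x))

IsRoundIdealFrame : Locale → Set₁
IsRoundIdealFrame L =
  Σ[ P ∈ PcdLattice ] Σ[ _◁_ ∈ (PcdLattice.Carrier P → PcdLattice.Carrier P → Set) ]
    (PcdNotions.IsStrongInclusion P _◁_ × Iso≅R L P _◁_)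

{-# OPTIONS --safe #-}
-- Forward: close the basis of L under finite meets, joins and pseudocomplements
-- (as terms, B*) and take the well-inside relation ≺ on it. All strong-inclusion
-- axioms but interpolation are frame algebra. For interpolation, regularity writes
-- x as the join of the basic elements well inside it, and compactness turns
-- t ≺ ⋁ S into t ≺ s for a finite join s of elements of S. Then x ↦ {t | t ≺ x}
-- and I ↦ ⋁ I are mutually inverse order isomorphisms between L and R(B*, ≺).
-- Backward: a join of round ideals consists of the elements below finite joins of
-- their members, so a cover of the top ideal (which contains 𝟙) has a finite
-- subcover, and compactness transports along the isomorphism. For regularity,
-- u ◁ v gives ⋁ ⇓u ≺ ⋁ ⇓v, and every round ideal is the join of ⇓u over its
-- members u.
module Submission where

open import Defs
open import Data.Bool using (Bool; true; false)
open import Data.Fin using (Fin; zero; suc; _↑ˡ_; _↑ʳ_)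
open import Data.Maybe using (Maybe; just; nothing; maybe′)
open import Data.Nat using (ℕ; zero; suc; _+_)
open import Data.Product using (_×_; Σ; Σ-syntax; _,_; proj₁; proj₂)
open import Data.Vec.Functional using (foldr; _++_)
open import Data.Vec.Functional.Properties using (lookup-++ˡ; lookup-++ʳ)
open import Function.Base using (_∘_)
open import Function.Bundles using (_⇔_; mk⇔; Equivalence)
open import Relation.Binary.PropositionalEquality using (_≡_; refl; sym; cong)

module FrameProperties (L : Locale) where
  open Locale L public
  open LocaleNotions L public

  ∨-ub₁ : ∀ {x y} → x ≤ (x ∨ y)
  ∨-ub₁ = ⋁-ub _ true

  ∨-ub₂ : ∀ {x y} → y ≤ (x ∨ y)
  ∨-ub₂ = ⋁-ub _ false

  ∨-lub : ∀ {x y z} → x ≤ z → y ≤ z → (x ∨ y) ≤ z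
  ∨-lub p q = ⋁-lub _ (λ { true → p ; false → q })

  ∨-mono : ∀ {x x′ y y′} → x ≤ x′ → y ≤ y′ → (x ∨ y) ≤ (x′ ∨ y′)
  ∨-mono p q = ∨-lub (≤-trans p ∨-ub₁) (≤-trans q ∨-ub₂)

  ∨-comm : ∀ {x y} → (x ∨ y) ≤ (y ∨ x)
  ∨-comm = ∨-lub ∨-ub₂ ∨-ub₁

  ⊥-min : ∀ {x} → ⊥L ≤ x
  ⊥-min = ⋁-lub _ (λ ())

  ∧-mono : ∀ {x x′ y y′} → x ≤ x′ → y ≤ y′ → (x ∧ y) ≤ (x′ ∧ y′)
  ∧-mono p q = ∧-glb (≤-trans ∧-lb₁ p) (≤-trans ∧-lb₂ q)

  ∧-comm : ∀ {x y} → (x ∧ y) ≤ (y ∧ x)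
  ∧-comm = ∧-glb ∧-lb₂ ∧-lb₁

  ∧-distribˡ-∨ : ∀ {x y z} → (x ∧ (y ∨ z)) ≤ ((x ∧ y) ∨ (x ∧ z))
  ∧-distribˡ-∨ {x} = ≤-trans (∧-⋁-distrib x _) (⋁-lub _ (λ { true → ∨-ub₁ ; false → ∨-ub₂ }))

  ∧-distribʳ-∨ : ∀ {x y z} → ((y ∨ z) ∧ x) ≤ ((y ∧ x) ∨ (z ∧ x))
  ∧-distribʳ-∨ = ≤-trans ∧-comm (≤-trans ∧-distribˡ-∨ (∨-mono ∧-comm ∧-comm))

  ∨-distribʳ-∧ : ∀ {x y z} → ((x ∨ z) ∧ (y ∨ z)) ≤ ((x ∧ y) ∨ z)
  ∨-distribʳ-∧ = ≤-trans ∧-distribʳ-∨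
    (∨-lub (≤-trans ∧-distribˡ-∨ (∨-mono ≤-refl ∧-lb₂)) (≤-trans ∧-lb₁ ∨-ub₂))

  ≤* : ∀ {x y} → (y ∧ x) ≤ ⊥L → y ≤ (x *)
  ≤* {x} {y} p = ≤-trans (generated y)
    (⋁-lub _ (λ (b , b≤y) → ⋁-ub _ (b , ≤-trans (∧-mono b≤y ≤-refl) p)))

  *∧≤⊥ : ∀ {x} → ((x *) ∧ x) ≤ ⊥L
  *∧≤⊥ {x} = ≤-trans ∧-comm (≤-trans (∧-⋁-distrib x _)
    (⋁-lub _ (λ (_ , b∧x≤⊥) → ≤-trans ∧-comm b∧x≤⊥)))

  *-antitone : ∀ {x y} → x ≤ y → (y *) ≤ (x *)
  *-antitone p = ≤* (≤-trans (∧-mono ≤-refl p) *∧≤⊥)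

  ≤** : ∀ {x} → x ≤ ((x *) *)
  ≤** = ≤* (≤-trans ∧-comm *∧≤⊥)

  *∧*≤∨* : ∀ {x y} → ((x *) ∧ (y *)) ≤ ((x ∨ y) *)
  *∧*≤∨* = ≤* (≤-trans ∧-distribˡ-∨
    (∨-lub (≤-trans (∧-mono ∧-lb₁ ≤-refl) *∧≤⊥) (≤-trans (∧-mono ∧-lb₂ ≤-refl) *∧≤⊥)))

  ≺-resp-≤ : ∀ {x x′ y y′} → x′ ≤ x → x ≺ y → y ≤ y′ → x′ ≺ y′
  ≺-resp-≤ p x≺y q = ≤-trans x≺y (∨-mono q (*-antitone p))

  ⊥≺ : ∀ {x} → ⊥L ≺ x
  ⊥≺ = ≤-trans (≤* ∧-lb₂) ∨-ub₂

  ≺⊤ : ∀ {x} → x ≺ ⊤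
  ≺⊤ = ∨-ub₁

  ∨-≺ : ∀ {x y z} → x ≺ z → y ≺ z → (x ∨ y) ≺ z
  ∨-≺ x≺z y≺z = ≤-trans (∧-glb (≤-trans x≺z ∨-comm) (≤-trans y≺z ∨-comm))
    (≤-trans ∨-distribʳ-∧ (≤-trans ∨-comm (∨-mono ≤-refl *∧*≤∨*)))

  ≺-∧ : ∀ {x y z} → x ≺ y → x ≺ z → x ≺ (y ∧ z)
  ≺-∧ x≺y x≺z = ≤-trans (∧-glb x≺y x≺z) ∨-distribʳ-∧

  ≺⇒≤ : ∀ {x y} → x ≺ y → x ≤ y
  ≺⇒≤ x≺y = ≤-trans (∧-glb ≤-refl (≤-trans ⊤-max x≺y))
    (≤-trans ∧-distribˡ-∨ (∨-lub ∧-lb₂ (≤-trans (≤-trans ∧-comm *∧≤⊥) ⊥-min)))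

  ≺-* : ∀ {x y} → x ≺ y → (y *) ≺ (x *)
  ≺-* x≺y = ≤-trans x≺y (∨-lub (≤-trans ≤** ∨-ub₂) ∨-ub₁)

  ⋁≺ : Carrier → Carrier
  ⋁≺ x = ⋁ {Σ[ b ∈ Basis ] (emb b ≺ x)} (emb ∘ proj₁)

  ⋁≺-mono : ∀ {x y} → x ≤ y → ⋁≺ x ≤ ⋁≺ y
  ⋁≺-mono p = ⋁-lub _ (λ (b , b≺x) → ⋁-ub _ (b , ≺-resp-≤ ≤-refl b≺x p))

  ⋁≺≤ : ∀ {x} → ⋁≺ x ≤ x
  ⋁≺≤ = ⋁-lub _ (≺⇒≤ ∘ proj₂)

  ≺⇒≤⋁≺ : ∀ {x y} → x ≺ y → x ≤ ⋁≺ y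
  ≺⇒≤⋁≺ {x} x≺y = ≤-trans (generated x)
    (⋁-lub _ (λ (b , b≤x) → ⋁-ub _ (b , ≺-resp-≤ b≤x x≺y ≤-refl)))

  regular⇒≤⋁≺ : IsRegular → ∀ x → x ≤ ⋁≺ x
  regular⇒≤⋁≺ regular x = ≤-trans (generated x)
    (⋁-lub _ (λ (b , b≤x) → ≤-trans (proj₁ (regular b)) (⋁≺-mono b≤x)))

  FiniteSubcover : {I : Set} → (I → Carrier) → Set
  FiniteSubcover {I} f = Σ[ n ∈ ℕ ] Σ[ h ∈ (Fin n → I) ] (⊤ ≤ ⋁ (f ∘ h))

  compact⇒finiteSubcover : IsCompact → ∀ {I : Set} (f : I → Carrier) →
                           ⊤ ≤ ⋁ f → FiniteSubcover f
  compact⇒finiteSubcover compact {I} f ⊤≤⋁f =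
    let (n , h , ⊤≤⋁h) = compact _ basic (≤-trans ⊤≤⋁f (⋁-lub f ≤⋁basic))
    in n , proj₁ ∘ h , ≤-trans ⊤≤⋁h (⋁-lub _ (λ k → ≤-trans (proj₂ (proj₂ (h k))) (⋁-ub _ k)))
    where
    basic : Σ[ i ∈ I ] Σ[ b ∈ Basis ] (emb b ≤ f i) → Basis
    basic = proj₁ ∘ proj₂
    ≤⋁basic : ∀ i → f i ≤ ⋁ (emb ∘ basic)
    ≤⋁basic i = ≤-trans (generated (f i)) (⋁-lub _ (λ b≤fi → ⋁-ub (emb ∘ basic) (i , b≤fi)))

  compact⇒≺-finite : IsCompact → ∀ {I : Set} (f : I → Carrier) {x} → x ≺ ⋁ f →
                     Σ[ n ∈ ℕ ] Σ[ h ∈ (Fin n → Maybe I) ] (x ≺ ⋁ (maybe′ f ⊥L ∘ h))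
  compact⇒≺-finite compact {I} f {x} x≺⋁f =
    let (n , h , ⊤≤⋁h) = compact⇒finiteSubcover compact cover
          (≤-trans x≺⋁f (∨-lub (⋁-lub f (λ i → ⋁-ub cover (just i))) (⋁-ub cover nothing)))
    in n , h , ≤-trans ⊤≤⋁h
         (⋁-lub _ (λ k → ≤-trans (split (h k)) (∨-mono (⋁-ub (maybe′ f ⊥L ∘ h) k) ≤-refl)))
    where
    -- nothing indexes the extra member x * of the cover; the subcover replaces it by ⊥L
    cover : Maybe I → Carrier
    cover = maybe′ f (x *)
    split : ∀ m → cover m ≤ (maybe′ f ⊥L m ∨ (x *))
    split (just i) = ∨-ub₁
    split nothing  = ∨-ub₂

module PcdLatticeProperties (P : PcdLattice) where
  open PcdLattice P
  open PcdNotions P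

  ≤-reflexive : ∀ {x y} → x ≡ y → x ≤ y
  ≤-reflexive refl = ≤-refl

  ≤*⇒∧≤𝟘 : ∀ {x y} → x ≤ (y *) → (x ∧ y) ≤ 𝟘
  ≤*⇒∧≤𝟘 = Equivalence.from pseudo

  ≤-and-≤*⇒≤𝟘 : ∀ {x y} → x ≤ y → x ≤ (y *) → x ≤ 𝟘
  ≤-and-≤*⇒≤𝟘 x≤y x≤y* = ≤-trans (∧-glb ≤-refl x≤y) (≤*⇒∧≤𝟘 x≤y*)

  ≺⇒≤ : ∀ {x y} → x ≺ y → x ≤ y
  ≺⇒≤ x≺y = ≤-trans (∧-glb ≤-refl (≤-trans 𝟙-max x≺y))
    (≤-trans distrib (∨-lub ∧-lb₂ (≤-trans (≤-and-≤*⇒≤𝟘 ∧-lb₁ ∧-lb₂) 𝟘-min)))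

  ⋁ᶠ : ∀ {n} → (Fin n → Carrier) → Carrier
  ⋁ᶠ = foldr _∨_ 𝟘

  ⋁ᶠ-closed : (Q : Carrier → Set) → Q 𝟘 → (∀ {x y} → Q x → Q y → Q (x ∨ y)) →
              ∀ {n} (f : Fin n → Carrier) → (∀ k → Q (f k)) → Q (⋁ᶠ f)
  ⋁ᶠ-closed Q Q𝟘 Q∨ {zero}  f Qf = Q𝟘
  ⋁ᶠ-closed Q Q𝟘 Q∨ {suc n} f Qf = Q∨ (Qf zero) (⋁ᶠ-closed Q Q𝟘 Q∨ (f ∘ suc) (Qf ∘ suc))

  ⋁ᶠ-ub : ∀ {n} (f : Fin n → Carrier) k → f k ≤ ⋁ᶠ f
  ⋁ᶠ-ub f zero    = ∨-ub₁
  ⋁ᶠ-ub f (suc k) = ≤-trans (⋁ᶠ-ub (f ∘ suc) k) ∨-ub₂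

  ⋁ᶠ-lub : ∀ {n} (f : Fin n → Carrier) {z} → (∀ k → f k ≤ z) → ⋁ᶠ f ≤ z
  ⋁ᶠ-lub f {z} = ⋁ᶠ-closed (_≤ z) 𝟘-min ∨-lub f

  ⋁ᶠ-++ : ∀ {A : Set} {m n} (v : A → Carrier) (e : Fin m → A) (e′ : Fin n → A) →
          (⋁ᶠ (v ∘ e) ∨ ⋁ᶠ (v ∘ e′)) ≤ ⋁ᶠ (v ∘ (e ++ e′))
  ⋁ᶠ-++ {m = m} {n} v e e′ = ∨-lub
    (⋁ᶠ-lub _ (λ k → ≤-trans (≤-reflexive (cong v (sym (lookup-++ˡ e e′ k)))) (⋁ᶠ-ub _ (k ↑ˡ n))))
    (⋁ᶠ-lub _ (λ k → ≤-trans (≤-reflexive (cong v (sym (lookup-++ʳ e e′ k)))) (⋁ᶠ-ub _ (m ↑ʳ k))))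

module RoundIdealFrame (P : PcdLattice) {_◁_ : PcdLattice.Carrier P → PcdLattice.Carrier P → Set}
                       (si : PcdNotions.IsStrongInclusion P _◁_) where
  open PcdLattice P
  open PcdNotions P
  open PcdLatticeProperties P
  open IsStrongInclusion si

  ◁⇒≤ : ∀ {x y} → x ◁ y → x ≤ y
  ◁⇒≤ = ≺⇒≤ ∘ si-≺

  ⋁ᶠ-◁ : ∀ {n} (f g : Fin n → Carrier) → (∀ k → f k ◁ g k) → ⋁ᶠ f ◁ ⋁ᶠ g
  ⋁ᶠ-◁ f g f◁g = ⋁ᶠ-closed (_◁ ⋁ᶠ g) (si-mono ≤-refl si-𝟘 𝟘-min) si-∨ f
    (λ k → si-mono ≤-refl (f◁g k) (⋁ᶠ-ub g k))

  ⇓ : Carrier → RoundIdeal _◁_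
  ⇓ u = record
    { mem      = _◁ u
    ; has-𝟘    = si-mono ≤-refl si-𝟘 𝟘-min
    ; down     = λ x≤y y◁u → si-mono x≤y y◁u ≤-refl
    ; ∨-closed = si-∨
    ; round    = λ x◁u → let (z , x◁z , z◁u) = si-interp x◁u in z , z◁u , x◁z
    }

  ⇓-least : ∀ (I : RoundIdeal _◁_) {u} → mem I u → ⇓ u ⊆ I
  ⇓-least I u∈I x x◁u = down I (◁⇒≤ x◁u) u∈I

  ⊆⇓𝟙 : ∀ (I : RoundIdeal _◁_) → I ⊆ ⇓ 𝟙
  ⊆⇓𝟙 I x x∈I = let (a , _ , x◁a) = round I x∈I in si-mono ≤-refl x◁a 𝟙-max

  module _ {I : Set} (F : I → RoundIdeal _◁_) where

    Member : Set
    Member = Σ[ i ∈ I ] Σ[ y ∈ Carrier ] mem (F i) y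

    elt : Member → Carrier
    elt = proj₁ ∘ proj₂

    successor : Member → Member
    successor (i , y , y∈Fi) = let (z , z∈Fi , _) = round (F i) y∈Fi in i , z , z∈Fi

    elt◁successor : ∀ e → elt e ◁ elt (successor e)
    elt◁successor (i , y , y∈Fi) = proj₂ (proj₂ (round (F i) y∈Fi))

    ⋃ : RoundIdeal _◁_
    ⋃ = record
      { mem      = λ x → Σ[ n ∈ ℕ ] Σ[ e ∈ (Fin n → Member) ] (x ≤ ⋁ᶠ (elt ∘ e))
      ; has-𝟘    = 0 , (λ ()) , ≤-refl
      ; down     = λ x≤y (n , e , y≤⋁) → n , e , ≤-trans x≤y y≤⋁
      ; ∨-closed = λ (m , e , x≤⋁) (n , e′ , y≤⋁) →
                     m + n , e ++ e′ , ≤-trans (∨-lub (≤-trans x≤⋁ ∨-ub₁) (≤-trans y≤⋁ ∨-ub₂))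
                                               (⋁ᶠ-++ elt e e′)
      ; round    = λ (n , e , x≤⋁) →
                     ⋁ᶠ (elt ∘ successor ∘ e) , (n , successor ∘ e , ≤-refl) ,
                     si-mono x≤⋁ (⋁ᶠ-◁ _ _ (elt◁successor ∘ e)) ≤-refl
      }

    ⋃-ub : ∀ i → F i ⊆ ⋃
    ⋃-ub i x x∈Fi = 1 , (λ _ → i , x , x∈Fi) , ∨-ub₁

    ⋃-least : ∀ (K : RoundIdeal _◁_) → (∀ i → F i ⊆ K) → ⋃ ⊆ K
    ⋃-least K Fi⊆K x (n , e , x≤⋁) =
      down K x≤⋁ (⋁ᶠ-closed (mem K) (has-𝟘 K) (∨-closed K) _
                   (λ k → let (i , y , y∈Fi) = e k in Fi⊆K i y y∈Fi))

  ⇓-members : (I : RoundIdeal _◁_) → Σ Carrier (mem I) → RoundIdeal _◁_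
  ⇓-members I = ⇓ ∘ proj₁

  ⊆⋃⇓-members : ∀ (I : RoundIdeal _◁_) → I ⊆ ⋃ (⇓-members I)
  ⊆⋃⇓-members I x x∈I = let (a , a∈I , x◁a) = round I x∈I in ⋃-ub (⇓-members I) (a , a∈I) x x◁a

module BasisClosure (L : Locale) where
  open FrameProperties L

  -- The paper's B* is the image of ⟦_⟧; working with terms keeps the carrier a set.
  data Term : Set where
    basic    : Basis → Term
    ⊥ᵗ ⊤ᵗ    : Term
    _∧ᵗ_ _∨ᵗ_ : Term → Term → Term
    _*ᵗ      : Term → Term

  ⟦_⟧ : Term → Carrier
  ⟦ basic b ⟧ = emb b
  ⟦ ⊥ᵗ ⟧      = ⊥L
  ⟦ ⊤ᵗ ⟧      = ⊤
  ⟦ s ∧ᵗ t ⟧  = ⟦ s ⟧ ∧ ⟦ t ⟧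
  ⟦ s ∨ᵗ t ⟧  = ⟦ s ⟧ ∨ ⟦ t ⟧
  ⟦ t *ᵗ ⟧    = ⟦ t ⟧ *

  B* : PcdLattice
  B* = record
    { Carrier = Term
    ; _≤_     = λ s t → ⟦ s ⟧ ≤ ⟦ t ⟧
    ; ≤-refl  = ≤-refl
    ; ≤-trans = ≤-trans
    ; 𝟘 = ⊥ᵗ ; 𝟙 = ⊤ᵗ
    ; 𝟘-min   = ⊥-min
    ; 𝟙-max   = ⊤-max
    ; _∧_ = _∧ᵗ_ ; _∨_ = _∨ᵗ_
    ; ∧-lb₁ = ∧-lb₁ ; ∧-lb₂ = ∧-lb₂ ; ∧-glb = ∧-glb
    ; ∨-ub₁ = ∨-ub₁ ; ∨-ub₂ = ∨-ub₂ ; ∨-lub = ∨-lub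
    ; distrib = ∧-distribˡ-∨
    ; _*      = _*ᵗ
    ; pseudo  = mk⇔ ≤* (λ y≤x* → ≤-trans (∧-mono y≤x* ≤-refl) *∧≤⊥)
    }

module CompactRegular⇒RoundIdealFrame (L : Locale) (compact : LocaleNotions.IsCompact L)
                                     (regular : LocaleNotions.IsRegular L) where
  open FrameProperties L
  open BasisClosure L
  open PcdLatticeProperties B* using (⋁ᶠ; ⋁ᶠ-closed; ⋁ᶠ-ub)
  open PcdNotions B* using (IsStrongInclusion; RoundIdeal; mem; has-𝟘; down; ∨-closed; round; _⊆_)
    renaming (_≺_ to _≺ᵗ_)

  ≺⋁-closed : (Q : Term → Set) → Q ⊥ᵗ → (∀ {s t} → Q s → Q t → Q (s ∨ᵗ t)) →
              ∀ {t} → ⟦ t ⟧ ≺ ⋁ {Σ Term Q} (⟦_⟧ ∘ proj₁) → Σ[ z ∈ Term ] (Q z × ⟦ t ⟧ ≺ ⟦ z ⟧)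
  ≺⋁-closed Q Q⊥ Q∨ t≺⋁ =
    let (n , h , t≺⋁h) = compact⇒≺-finite compact (⟦_⟧ ∘ proj₁) t≺⋁
    in ⋁ᶠ (member ∘ h) ,
       ⋁ᶠ-closed Q Q⊥ Q∨ (member ∘ h) (Q-member ∘ h) ,
       ≺-resp-≤ ≤-refl t≺⋁h (⋁-lub _ (λ k → ≤-trans (⟦member⟧ (h k)) (⋁ᶠ-ub (member ∘ h) k)))
    where
    member : Maybe (Σ Term Q) → Term
    member = maybe′ proj₁ ⊥ᵗ
    Q-member : ∀ m → Q (member m)
    Q-member (just (s , Qs)) = Qs
    Q-member nothing         = Q⊥
    ⟦member⟧ : ∀ m → maybe′ (⟦_⟧ ∘ proj₁) ⊥L m ≤ ⟦ member m ⟧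
    ⟦member⟧ (just _) = ≤-refl
    ⟦member⟧ nothing  = ≤-refl

  ≤⋁≺ᵗ : ∀ x → x ≤ ⋁ {Σ[ s ∈ Term ] (⟦ s ⟧ ≺ x)} (⟦_⟧ ∘ proj₁)
  ≤⋁≺ᵗ x = ≤-trans (regular⇒≤⋁≺ regular x) (⋁-lub _ (λ (b , b≺x) → ⋁-ub _ (basic b , b≺x)))

  ≺-interpolate : ∀ {t x} → ⟦ t ⟧ ≺ x → Σ[ z ∈ Term ] (⟦ t ⟧ ≺ ⟦ z ⟧ × ⟦ z ⟧ ≺ x)
  ≺-interpolate {t} {x} t≺x =
    let (z , z≺x , t≺z) = ≺⋁-closed (λ s → ⟦ s ⟧ ≺ x) ⊥≺ ∨-≺ {t} (≺-resp-≤ ≤-refl t≺x (≤⋁≺ᵗ x))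
    in z , t≺z , z≺x

  ≺ᵗ-isStrongInclusion : IsStrongInclusion _≺ᵗ_
  ≺ᵗ-isStrongInclusion = record
    { si-𝟘      = ⊥≺
    ; si-𝟙      = ≺⊤
    ; si-mono   = ≺-resp-≤
    ; si-∧      = ≺-∧
    ; si-∨      = ∨-≺
    ; si-*      = ≺-*
    ; si-≺      = λ s≺t → s≺t
    ; si-interp = λ {s} → ≺-interpolate {s}
    }

  to : Carrier → RoundIdeal _≺ᵗ_
  to x = record
    { mem      = λ t → ⟦ t ⟧ ≺ x
    ; has-𝟘    = ⊥≺
    ; down     = λ s≤t t≺x → ≺-resp-≤ s≤t t≺x ≤-refl
    ; ∨-closed = ∨-≺
    ; round    = λ {t} t≺x → let (z , t≺z , z≺x) = ≺-interpolate {t} t≺x in z , z≺x , t≺z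
    }

  from : RoundIdeal _≺ᵗ_ → Carrier
  from I = ⋁ {Σ Term (mem I)} (⟦_⟧ ∘ proj₁)

  iso : Iso≅R L B* _≺ᵗ_
  iso = record
    { to        = to
    ; from      = from
    ; to-mono   = λ x≤y t t≺x → ≺-resp-≤ ≤-refl t≺x x≤y
    ; from-mono = λ I⊆J → ⋁-lub _ (λ (t , t∈I) → ⋁-ub _ (t , I⊆J t t∈I))
    ; to-from   = λ I → to-from⊆ I , ⊆to-from I
    ; from-to   = λ x → ⋁-lub _ (≺⇒≤ ∘ proj₂) , ≤⋁≺ᵗ x
    }
    where
    to-from⊆ : ∀ I → to (from I) ⊆ I
    to-from⊆ I t t≺⋁I =
      let (z , z∈I , t≺z) = ≺⋁-closed (mem I) (has-𝟘 I) (∨-closed I) {t} t≺⋁I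
      in down I (≺⇒≤ t≺z) z∈I
    ⊆to-from : ∀ I → I ⊆ to (from I)
    ⊆to-from I t t∈I =
      let (a , a∈I , t≺a) = round I t∈I in ≺-resp-≤ ≤-refl t≺a (⋁-ub (⟦_⟧ ∘ proj₁) (a , a∈I))

  isRoundIdealFrame : IsRoundIdealFrame L
  isRoundIdealFrame = B* , _≺ᵗ_ , ≺ᵗ-isStrongInclusion , iso

module RoundIdealFrame⇒CompactRegular
         (L : Locale) (P : PcdLattice) {_◁_ : PcdLattice.Carrier P → PcdLattice.Carrier P → Set}
         (si : PcdNotions.IsStrongInclusion P _◁_) (iso : Iso≅R L P _◁_) where
  open FrameProperties L
  open PcdLattice P using (𝟘; 𝟙) renaming (_*  to _*ᴾ; _≤_ to _≤ᴾ_; ≤-refl to ≤ᴾ-refl)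
  open PcdLatticeProperties P using (⋁ᶠ-closed; ≤-and-≤*⇒≤𝟘)
  open PcdNotions P using (RoundIdeal; mem; has-𝟘; down; ∨-closed; round; _⊆_)
  open PcdNotions.IsStrongInclusion si
  open RoundIdealFrame P si
  open Iso≅R iso

  to⊆ : ∀ {x} (K : RoundIdeal _◁_) → x ≤ from K → to x ⊆ K
  to⊆ K x≤K y = proj₁ (to-from K) y ∘ to-mono x≤K y

  ⊆to : ∀ {x} (K : RoundIdeal _◁_) → from K ≤ x → K ⊆ to x
  ⊆to K K≤x y = to-mono K≤x y ∘ proj₂ (to-from K) y

  ≤from : ∀ {x} (K : RoundIdeal _◁_) → to x ⊆ K → x ≤ from K
  ≤from {x} K x⊆K = ≤-trans (proj₂ (from-to x)) (from-mono x⊆K)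

  from≤ : ∀ {x} (K : RoundIdeal _◁_) → K ⊆ to x → from K ≤ x
  from≤ {x} K K⊆x = ≤-trans (from-mono K⊆x) (proj₁ (from-to x))

  from-⋃ : ∀ {I : Set} (F : I → RoundIdeal _◁_) → from (⋃ F) ≤ ⋁ (from ∘ F)
  from-⋃ F = from≤ (⋃ F) (⋃-least F (to (⋁ (from ∘ F))) (λ i → ⊆to (F i) (⋁-ub (from ∘ F) i)))

  to-⋁ : ∀ {I : Set} (f : I → Carrier) → to (⋁ f) ⊆ ⋃ (to ∘ f)
  to-⋁ f = to⊆ (⋃ (to ∘ f)) (⋁-lub f (λ i → ≤from (⋃ (to ∘ f)) (⋃-ub (to ∘ f) i)))

  𝟙∈⇒⊤≤from : ∀ (K : RoundIdeal _◁_) → mem K 𝟙 → ⊤ ≤ from K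
  𝟙∈⇒⊤≤from K 𝟙∈K = ≤from K (λ y → ⇓-least K 𝟙∈K y ∘ ⊆⇓𝟙 (to ⊤) y)

  ⊤≤⇒𝟙∈to : ∀ {x} → ⊤ ≤ x → mem (to x) 𝟙
  ⊤≤⇒𝟙∈to ⊤≤x = ⊆to (⇓ 𝟙) (≤-trans ⊤-max ⊤≤x) 𝟙 si-𝟙

  from-disjoint : ∀ (K M : RoundIdeal _◁_) → (∀ y → mem K y → mem M y → y ≤ᴾ 𝟘) →
                  (from K ∧ from M) ≤ ⊥L
  from-disjoint K M disjoint =
    ≤-trans (≤from (⇓ 𝟘) K∧M⊆⇓𝟘) (from≤ (⇓ 𝟘) (⇓-least (to ⊥L) (has-𝟘 (to ⊥L))))
    where
    K∧M⊆⇓𝟘 : to (from K ∧ from M) ⊆ ⇓ 𝟘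
    K∧M⊆⇓𝟘 y y∈K∧M = si-mono (disjoint y (to⊆ K ∧-lb₁ y y∈K∧M) (to⊆ M ∧-lb₂ y y∈K∧M)) si-𝟘 ≤ᴾ-refl

  -- Interpolating u ◁ w ◁ w′ ◁ v gives 𝟙 ≤ w′ ∨ w * with w′ ◁ v and w * ◁ u *,
  -- while ⇓ (u *) and ⇓ u are disjoint.
  from-⇓-≺ : ∀ {u v} → u ◁ v → from (⇓ u) ≺ from (⇓ v)
  from-⇓-≺ {u} {v} u◁v =
    let (w , u◁w , w◁v)   = si-interp u◁v
        (w′ , w◁w′ , w′◁v) = si-interp w◁v
        𝟙∈⋃ : mem (⋃ halves) 𝟙
        𝟙∈⋃ = down (⋃ halves) (si-≺ w◁w′)
                (∨-closed (⋃ halves) (⋃-ub halves true w′ w′◁v)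
                                     (⋃-ub halves false (w *ᴾ) (si-* u◁w)))
    in ≤-trans (𝟙∈⇒⊤≤from (⋃ halves) 𝟙∈⋃) (≤-trans (from-⋃ halves)
         (⋁-lub _ (λ { true → ∨-ub₁ ; false → ≤-trans (≤* from-⇓u*∧⇓u≤⊥) ∨-ub₂ })))
    where
    halves : Bool → RoundIdeal _◁_
    halves true  = ⇓ v
    halves false = ⇓ (u *ᴾ)
    from-⇓u*∧⇓u≤⊥ : (from (⇓ (u *ᴾ)) ∧ from (⇓ u)) ≤ ⊥L
    from-⇓u*∧⇓u≤⊥ = from-disjoint (⇓ (u *ᴾ)) (⇓ u) (λ y y◁u* y◁u → ≤-and-≤*⇒≤𝟘 (◁⇒≤ y◁u) (◁⇒≤ y◁u*))

  finiteSubcover : ∀ {I : Set} (f : I → Carrier) → ⊤ ≤ ⋁ f → FiniteSubcover f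
  finiteSubcover f ⊤≤⋁f =
    let (n , e , 𝟙≤⋁e) = to-⋁ f 𝟙 (⊤≤⇒𝟙∈to ⊤≤⋁f)
        K : RoundIdeal _◁_
        K = to (⋁ (f ∘ proj₁ ∘ e))
        e∈K : ∀ k → mem K (elt (to ∘ f) (e k))
        e∈K k = to-mono (⋁-ub (f ∘ proj₁ ∘ e) k) _ (proj₂ (proj₂ (e k)))
        𝟙∈K : mem K 𝟙
        𝟙∈K = down K 𝟙≤⋁e (⋁ᶠ-closed (mem K) (has-𝟘 K) (∨-closed K) _ e∈K)
    in n , proj₁ ∘ e , ≤-trans (𝟙∈⇒⊤≤from K 𝟙∈K) (proj₁ (from-to _))

  isCompact : IsCompact
  isCompact I g = finiteSubcover (emb ∘ g)

  isRegular : IsRegular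
  isRegular a =
    ≤-trans (≤from (⋃ (⇓-members I)) (⊆⋃⇓-members I))
            (≤-trans (from-⋃ (⇓-members I)) (⋁-lub _ ⇓-member≤⋁≺)) ,
    ⋁≺≤
    where
    I : RoundIdeal _◁_
    I = to (emb a)
    ⇓-member≤⋁≺ : ∀ (x : Σ _ (mem I)) → from (⇓ (proj₁ x)) ≤ ⋁≺ (emb a)
    ⇓-member≤⋁≺ (x , x∈I) =
      let (y , y∈I , x◁y) = round I x∈I
      in ≺⇒≤⋁≺ (≺-resp-≤ ≤-refl (from-⇓-≺ x◁y) (from≤ (⇓ y) (⇓-least I y∈I)))

mainTheorem14 : (L : Locale) →
    (LocaleNotions.IsCompact L × LocaleNotions.IsRegular L) ⇔ IsRoundIdealFrame L
mainTheorem14 L = mk⇔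
  (λ (compact , regular) → CompactRegular⇒RoundIdealFrame.isRoundIdealFrame L compact regular)
  (λ (P , _ , si , iso) → RoundIdealFrame⇒CompactRegular.isCompact L P si iso ,
                          RoundIdealFrame⇒CompactRegular.isRegular L P si iso)
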